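{- For every $n\geq 1$, the number of shallow $231$-avoiding involutions of length $n$ is $2^{n-1}$.
   Context: For $\pi=\pi_1\cdots\pi_n \in S_n$: $D(\pi)=\sum_{i=1}^n|\pi_i-i|$; $I(\pi)=|\{(i,j): i<j,\ \pi_i>\pi_j\}|$; $T(\pi)=n-\mathrm{cyc}(\pi)$ where $\mathrm{cyc}(\pi)$ is the number of cycles of $\pi$. $\pi$ is shallow if $I(\pi)+T(\pi)=D(\pi)$. $\pi$ avoids $231$ if there are no $i<j<k$ with $\pi_k<\pi_i<\pi_j$. An involution is a permutation with $\pi=\pi^{ -1}$. -}

module Defs where

open import Data.Nat using (ℕ; zero; suc; _+_; _∸_; _<_; _≤_; ∣_-_∣)
open import Data.Nat.Properties using (_<?_; _≤?_)
open import Data.Fin using (Fin; toℕ)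
open import Data.Fin.Properties using (all?; any?; _≟_)
open import Data.Vec using (Vec; []; _∷_; lookup)
open import Data.List using (List; [_]; concatMap; map; filter; length; allFin)
open import Data.Nat.ListAction using (sum)
open import Data.Product using (_×_; ∃-syntax; _,_)
open import Relation.Nullary using (Dec; ¬_; _×-dec_; ¬?)
open import Relation.Binary.PropositionalEquality using (_≡_)
open import Relation.Nullary.Decidable using (_→-dec_)

-- A word of length n over {0,…,n-1}: π = π₀ ⋯ π_{n-1}, written 0-based
-- (shifting all values and positions by 1 does not change D, I, T, 231-avoidance).
Word : ℕ → Set
Word n = Vec (Fin n) n

allVecs : (n m : ℕ) → List (Vec (Fin n) m)
allVecs n zero    = [ [] ]
allVecs n (suc m) = concatMap (λ x → map (x ∷_) (allVecs n m)) (allFin n)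

module _ {n : ℕ} (π : Word n) where

  val : Fin n → ℕ
  val i = toℕ (lookup π i)

  -- π is a permutation: injective (hence bijective on Fin n)
  IsPerm : Set
  IsPerm = ∀ i j → lookup π i ≡ lookup π j → i ≡ j

  IsInvolution : Set
  IsInvolution = ∀ i → lookup π (lookup π i) ≡ i

  Avoids231 : Set
  Avoids231 = ∀ i j k → toℕ i < toℕ j → toℕ j < toℕ k →
              ¬ (val k < val i × val i < val j)

  Dis : ℕ
  Dis = sum (map (λ i → ∣ val i - toℕ i ∣) (allFin n))

  Inv : ℕ
  Inv = sum (map (λ i → length (filter (λ j → toℕ i <? toℕ j ×-dec val j <? val i)
                                       (allFin n)))
                 (allFin n))

  iter : ℕ → Fin n → Fin n
  iter zero    i = i
  iter (suc k) i = lookup π (iter k i)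

  -- i is the smallest element of its cycle: toℕ i ≤ π^k(i) for k = 1,…,n
  -- (every cycle has length ≤ n, so this visits the whole cycle)
  CycleMin : Fin n → Set
  CycleMin i = ∀ (k : Fin n) → toℕ i ≤ toℕ (iter (suc (toℕ k)) i)

  cycleMin? : ∀ i → Dec (CycleMin i)
  cycleMin? i = all? (λ k → toℕ i ≤? toℕ (iter (suc (toℕ k)) i))

  -- cyc(π) = number of cycles = number of cycle minima
  cyc : ℕ
  cyc = length (filter cycleMin? (allFin n))

  Tra : ℕ
  Tra = n ∸ cyc

  Shallow : Set
  Shallow = Inv + Tra ≡ Dis

perm? : ∀ {n} (π : Word n) → Dec (IsPerm π)
perm? π = all? λ i → all? λ j → (lookup π i ≟ lookup π j) →-dec (i ≟ j)

invol? : ∀ {n} (π : Word n) → Dec (IsInvolution π)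
invol? π = all? λ i → lookup π (lookup π i) ≟ i

avoids231? : ∀ {n} (π : Word n) → Dec (Avoids231 π)
avoids231? π = all? λ i → all? λ j → all? λ k →
  (toℕ i <? toℕ j) →-dec ((toℕ j <? toℕ k)
    →-dec (¬? (val π k <? val π i ×-dec val π i <? val π j)))

shallow? : ∀ {n} (π : Word n) → Dec (Shallow π)
shallow? π = Data.Nat.Properties._≟_ (Inv π + Tra π) (Dis π)
  where import Data.Nat.Properties

ShallowAvoidingInvolution : ∀ {n} → Word n → Set
ShallowAvoidingInvolution π = IsPerm π × IsInvolution π × Avoids231 π × Shallow π

sai? : ∀ {n} (π : Word n) → Dec (ShallowAvoidingInvolution π)
sai? π = perm? π ×-dec invol? π ×-dec avoids231? π ×-dec shallow? π

countSAI : ℕ → ℕ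
countSAI n = length (filter sai? (allVecs n n))

-- A 231-avoiding involution f of {0,…,n-1} is layered. With k = f 0 we have f k = 0, so an
-- ascent f j < f (j+1) with j + 1 < k would form a 231 pattern together with k; hence f reverses
-- the block {0,…,k} and restricts to a smaller 231-avoiding involution of {k+1,…,n-1}. Conversely
-- every layered permutation is a 231-avoiding involution, and layered permutations of {0,…,n-1}
-- correspond to compositions of n, i.e. to the 2^(n-1) bit strings of length n-1. They are all
-- shallow: I, D and cyc are additive over blocks, and a reversed block of size c+1 satisfies
-- I + (c+1) = D + cyc, by induction c ↦ c+2.

{-# OPTIONS --safe #-}
module Submission where

open import Defs
open import Data.Empty using (⊥-elim)
open import Data.Fin using (Fin; toℕ; fromℕ<) renaming (zero to fzero; suc to fsuc)
open import Data.Fin.Properties using (toℕ-injective; toℕ<n; toℕ-fromℕ<; fromℕ<-toℕ)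
open import Data.List using (List; []; _∷_; _++_; map; concatMap; cartesianProductWith; filter; length; allFin)
import Data.List as List
open import Data.List.Membership.Propositional using (_∈_)
open import Data.List.Membership.Propositional.Properties
  using (∈-cartesianProductWith⁺; ∈-filter⁺; ∈-filter⁻; ∈-allFin; ∈-map⁺; ∈-map⁻)
open import Data.List.Membership.Propositional.Properties.WithK using (unique∧set⇒bag)
open import Data.List.Properties using (∷-injective; length-map; length-++; length-tabulate; length-filter; map-tabulate)
open import Data.List.Relation.Binary.BagAndSetEquality using (∼bag⇒↭)
open import Data.List.Relation.Binary.Permutation.Propositional.Properties using (↭-length)
open import Data.List.Relation.Unary.All using ([])
open import Data.List.Relation.Unary.AllPairs using ([]; _∷_)
open import Data.List.Relation.Unary.Any using (here)
open import Data.List.Relation.Unary.Unique.Propositional using (Unique)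
import Data.List.Relation.Unary.Unique.Propositional.Properties as Unique
open import Data.Nat
open import Data.Nat.Induction using (<-rec)
open import Data.Nat.ListAction using (sum)
open import Data.Nat.Properties
open import Algebra.Properties.CommutativeSemigroup +-commutativeSemigroup using (interchange)
open import Data.Nat.Tactic.RingSolver using (solve-∀)
open import Data.Product using (_×_; _,_; proj₁; proj₂; ∃-syntax; Σ-syntax; uncurry)
open import Data.Sum using (_⊎_; inj₁; inj₂)
open import Data.Vec using (Vec; []; _∷_; lookup; tabulate)
open import Data.Vec.Properties using (lookup∘tabulate; tabulate∘lookup; tabulate-cong)
import Data.Vec.Properties as Vec
open import Function using (_∘_; _⇔_; mk⇔; Equivalence)
open import Relation.Binary.PropositionalEquality
  using (_≡_; refl; sym; trans; cong; cong₂; subst; subst₂; module ≡-Reasoning)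
open import Relation.Nullary using (Dec; yes; no; ¬_; contradiction)
open import Relation.Nullary.Decidable using (_×-dec_)
open import Relation.Unary using (Pred; Decidable)

-- Counting by enumeration

length-filter-enumeration : ∀ {a p} {A : Set a} {P : Pred A p} (P? : Decidable P) {xs ys : List A} →
  Unique xs → (∀ z → z ∈ xs) → Unique ys → (∀ {z} → z ∈ ys → P z) → (∀ {z} → P z → z ∈ ys) →
  length (filter P? xs) ≡ length ys
length-filter-enumeration P? {xs} {ys} xs-unique xs-complete ys-unique ys⊆P P⊆ys =
  ↭-length (∼bag⇒↭ (unique∧set⇒bag (Unique.filter⁺ P? xs-unique) ys-unique (mk⇔ to from)))
  where
  to : ∀ {z} → z ∈ filter P? xs → z ∈ ys
  to z∈ = P⊆ys (proj₂ (∈-filter⁻ P? {xs = xs} z∈))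
  from : ∀ {z} → z ∈ ys → z ∈ filter P? xs
  from z∈ = ∈-filter⁺ P? (xs-complete _) (ys⊆P z∈)

module _ {a b c} {A : Set a} {B : Set b} {C : Set c} (f : A → B → C) where

  concatMap≡cartesianProductWith : ∀ xs ys →
    concatMap (λ x → map (f x) ys) xs ≡ cartesianProductWith f xs ys
  concatMap≡cartesianProductWith []       ys = refl
  concatMap≡cartesianProductWith (x ∷ xs) ys = cong (map (f x) ys ++_) (concatMap≡cartesianProductWith xs ys)

  length-cartesianProductWith : ∀ xs ys → length (cartesianProductWith f xs ys) ≡ length xs * length ys
  length-cartesianProductWith []       ys = refl
  length-cartesianProductWith (x ∷ xs) ys =
    trans (length-++ (map (f x) ys)) (cong₂ _+_ (length-map (f x) ys) (length-cartesianProductWith xs ys))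

allVecs-suc : ∀ n m → allVecs n (suc m) ≡ cartesianProductWith _∷_ (allFin n) (allVecs n m)
allVecs-suc n m = concatMap≡cartesianProductWith _∷_ (allFin n) (allVecs n m)

∈-allVecs : ∀ {n m} (v : Vec (Fin n) m) → v ∈ allVecs n m
∈-allVecs []      = here refl
∈-allVecs {n} {suc m} (x ∷ v) rewrite allVecs-suc n m = ∈-cartesianProductWith⁺ _∷_ (∈-allFin x) (∈-allVecs v)

allVecs-unique : ∀ n m → Unique (allVecs n m)
allVecs-unique n zero    = [] ∷ []
allVecs-unique n (suc m) rewrite allVecs-suc n m =
  Unique.cartesianProductWith⁺ _∷_ Vec.∷-injective (Unique.allFin⁺ n) (allVecs-unique n m)

length-allVecs : ∀ n m → length (allVecs n m) ≡ n ^ m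
length-allVecs n zero    = refl
length-allVecs n (suc m) rewrite allVecs-suc n m =
  trans (length-cartesianProductWith _∷_ (allFin n) (allVecs n m))
        (cong₂ _*_ (length-tabulate {n = n} (λ i → i)) (length-allVecs n m))

-- Finite sums

∑< : ℕ → (ℕ → ℕ) → ℕ
∑< zero    h = 0
∑< (suc n) h = h 0 + ∑< n (h ∘ suc)

syntax ∑< n (λ i → e) = ∑[ i < n ] e

∑-cong : ∀ n {h h′ : ℕ → ℕ} → (∀ {i} → i < n → h i ≡ h′ i) → ∑< n h ≡ ∑< n h′
∑-cong zero    h≡h′ = refl
∑-cong (suc n) h≡h′ = cong₂ _+_ (h≡h′ z<s) (∑-cong n (h≡h′ ∘ s<s))

∑-zero : ∀ n {h : ℕ → ℕ} → (∀ {i} → i < n → h i ≡ 0) → ∑< n h ≡ 0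
∑-zero zero    h≡0 = refl
∑-zero (suc n) h≡0 = cong₂ _+_ (h≡0 z<s) (∑-zero n (h≡0 ∘ s<s))

∑-+ : ∀ m k (h : ℕ → ℕ) → ∑< (m + k) h ≡ ∑< m h + ∑[ i < k ] h (m + i)
∑-+ zero    k h = refl
∑-+ (suc m) k h = trans (cong (h 0 +_) (∑-+ m k (h ∘ suc))) (sym (+-assoc (h 0) _ _))

∑-snoc : ∀ n (h : ℕ → ℕ) → ∑< (suc n) h ≡ ∑< n h + h n
∑-snoc zero    h = +-identityʳ (h 0)
∑-snoc (suc n) h = trans (cong (h 0 +_) (∑-snoc n (h ∘ suc))) (sym (+-assoc (h 0) _ _))

𝟙 : ∀ {p} {P : Set p} → Dec P → ℕ
𝟙 (yes _) = 1
𝟙 (no _)  = 0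

𝟙-cong : ∀ {p q} {P : Set p} {Q : Set q} (P? : Dec P) (Q? : Dec Q) → (P → Q) → (Q → P) → 𝟙 P? ≡ 𝟙 Q?
𝟙-cong (yes _) (yes _) _   _   = refl
𝟙-cong (yes p) (no ¬q) P→Q _   = ⊥-elim (¬q (P→Q p))
𝟙-cong (no ¬p) (yes q) _   Q→P = ⊥-elim (¬p (Q→P q))
𝟙-cong (no _)  (no _)  _   _   = refl

𝟙-no : ∀ {p} {P : Set p} (P? : Dec P) → ¬ P → 𝟙 P? ≡ 0
𝟙-no (yes p) ¬p = ⊥-elim (¬p p)
𝟙-no (no _)  _  = refl

length-filter≡sum-𝟙 : ∀ {a p} {A : Set a} {P : Pred A p} (P? : Decidable P) xs →
  length (filter P? xs) ≡ sum (map (𝟙 ∘ P?) xs)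
length-filter≡sum-𝟙 P? []       = refl
length-filter≡sum-𝟙 P? (x ∷ xs) with P? x
... | yes _ = cong suc (length-filter≡sum-𝟙 P? xs)
... | no _  = length-filter≡sum-𝟙 P? xs

∑-𝟙-< : ∀ i m → ∑[ j < m ] 𝟙 (i <? j) ≡ m ∸ suc i
∑-𝟙-< i zero    = refl
∑-𝟙-< i (suc m) = trans (∑-snoc m _) (last (i <? m))
  where
  open ≡-Reasoning
  last : (i<m? : Dec (i < m)) → ∑[ j < m ] 𝟙 (i <? j) + 𝟙 i<m? ≡ suc m ∸ suc i
  last (yes i<m) = begin
    ∑[ j < m ] 𝟙 (i <? j) + 1 ≡⟨ cong (_+ 1) (∑-𝟙-< i m) ⟩
    m ∸ suc i + 1             ≡⟨ +-comm (m ∸ suc i) 1 ⟩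
    suc (m ∸ suc i)           ≡⟨ +-∸-assoc 1 i<m ⟨
    suc m ∸ suc i             ∎
  last (no i≮m) = begin
    ∑[ j < m ] 𝟙 (i <? j) + 0 ≡⟨ +-identityʳ _ ⟩
    ∑[ j < m ] 𝟙 (i <? j)     ≡⟨ ∑-𝟙-< i m ⟩
    m ∸ suc i                 ≡⟨ m≤n⇒m∸n≡0 (m≤n⇒m≤1+n (≮⇒≥ i≮m)) ⟩
    0                         ≡⟨ m≤n⇒m∸n≡0 (≮⇒≥ i≮m) ⟨
    suc m ∸ suc i             ∎

-- 231-avoiding involutions are layered

record Is231AvoidingInvolution (n : ℕ) (f : ℕ → ℕ) : Set where
  field
    bounded    : ∀ {i} → i < n → f i < n
    involutive : ∀ {i} → i < n → f (f i) ≡ i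
    avoids231  : ∀ {i j k} → i < j → j < k → k < n → ¬ (f k < f i × f i < f j)

  injective : ∀ {i j} → i < n → j < n → f i ≡ f j → i ≡ j
  injective {i} {j} i<n j<n fi≡fj =
    trans (sym (involutive i<n)) (trans (cong f fi≡fj) (involutive j<n))

-- c ∷ cs encodes the layered permutation that reverses {0,…,c} and continues with cs shifted by c+1.
size : List ℕ → ℕ
size []       = 0
size (c ∷ cs) = suc c + size cs

layered : List ℕ → ℕ → ℕ
layered []       i = i
layered (c ∷ cs) i with i ≤? c
... | yes _ = c ∸ i
... | no  _ = suc c + layered cs (i ∸ suc c)

layered-block : ∀ c cs {i} → i ≤ c → layered (c ∷ cs) i ≡ c ∸ i
layered-block c cs {i} i≤c with i ≤? c
... | yes _   = refl
... | no  i≰c = ⊥-elim (i≰c i≤c)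

pastBlock≰block : ∀ c i → ¬ (suc c + i ≤ c)
pastBlock≰block c i 1+c+i≤c = 1+n≰n (m+n≤o⇒m≤o (suc c) 1+c+i≤c)

layered-shift : ∀ c cs i → layered (c ∷ cs) (suc c + i) ≡ suc c + layered cs i
layered-shift c cs i with suc c + i ≤? c
... | yes 1+c+i≤c = ⊥-elim (pastBlock≰block c i 1+c+i≤c)
... | no  _         = cong (λ x → suc c + layered cs x) (m+n∸m≡n (suc c) i)

layered-block<shift : ∀ c cs {i} → i ≤ c → ∀ j → layered (c ∷ cs) i < layered (c ∷ cs) (suc c + j)
layered-block<shift c cs {i} i≤c j = subst₂ _<_ (sym (layered-block c cs i≤c)) (sym (layered-shift c cs j))
  (s≤s (≤-trans (m∸n≤m c i) (m≤m+n c (layered cs j))))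

data BlockView (c : ℕ) : ℕ → Set where
  inBlock   : ∀ {i} → i ≤ c → BlockView c i
  pastBlock : ∀ i → BlockView c (suc c + i)

blockView : ∀ c i → BlockView c i
blockView c i with i ≤? c
... | yes i≤c = inBlock i≤c
... | no  i≰c = subst (BlockView c) (m+[n∸m]≡n (≰⇒> i≰c)) (pastBlock (i ∸ suc c))

layered-avoiding : ∀ cs → Is231AvoidingInvolution (size cs) (layered cs)
layered-avoiding []       = record
  { bounded    = λ i<0 → i<0
  ; involutive = λ _ → refl
  ; avoids231  = λ i<j j<k _ (k<i , _) → <-asym (<-trans i<j j<k) k<i
  }
layered-avoiding (c ∷ cs) = record { bounded = bounded ; involutive = involutive ; avoids231 = avoids231 }
  where
  module G = Is231AvoidingInvolution (layered-avoiding cs)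
  M : ℕ
  M = size cs
  f g : ℕ → ℕ
  f = layered (c ∷ cs)
  g = layered cs

  unshift : ∀ {i j} → suc c + i < suc c + j → i < j
  unshift = +-cancelˡ-< (suc c) _ _

  bounded : ∀ {i} → i < suc c + M → f i < suc c + M
  bounded {i} i<N with blockView c i
  ... | inBlock i≤c = subst (_< suc c + M) (sym (layered-block c cs i≤c))
                        (s≤s (≤-trans (m∸n≤m c i) (m≤m+n c M)))
  ... | pastBlock i = subst (_< suc c + M) (sym (layered-shift c cs i))
                        (+-monoʳ-< (suc c) (G.bounded (unshift i<N)))

  involutive : ∀ {i} → i < suc c + M → f (f i) ≡ i
  involutive {i} i<N with blockView c i
  ... | inBlock i≤c = trans (cong f (layered-block c cs i≤c))
                        (trans (layered-block c cs (m∸n≤m c i)) (m∸[m∸n]≡n i≤c))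
  ... | pastBlock i = trans (cong f (layered-shift c cs i))
                        (trans (layered-shift c cs (g i)) (cong (suc c +_) (G.involutive (unshift i<N))))

  avoids231 : ∀ {i j k} → i < j → j < k → k < suc c + M → ¬ (f k < f i × f i < f j)
  avoids231 {i} {j} {k} i<j j<k k<N (fk<fi , fi<fj) with blockView c i | blockView c j | blockView c k
  ... | inBlock i≤c | inBlock j≤c | inBlock _ =
    <⇒≱ (subst₂ _<_ (layered-block c cs i≤c) (layered-block c cs j≤c) fi<fj) (∸-monoʳ-≤ c (<⇒≤ i<j))
  ... | inBlock i≤c | _ | pastBlock k = <-asym fk<fi (layered-block<shift c cs i≤c k)
  ... | _ | pastBlock j | inBlock k≤c = pastBlock≰block c j (<⇒≤ (<-≤-trans j<k k≤c))
  ... | pastBlock i | inBlock j≤c | _ = pastBlock≰block c i (<⇒≤ (<-≤-trans i<j j≤c))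
  ... | pastBlock i | pastBlock j | pastBlock k =
    G.avoids231 (unshift i<j) (unshift j<k) (unshift k<N)
      ( unshift (subst₂ _<_ (layered-shift c cs k) (layered-shift c cs i) fk<fi)
      , unshift (subst₂ _<_ (layered-shift c cs i) (layered-shift c cs j) fi<fj))

module _ {k} (f : ℕ → ℕ) (decreasing : ∀ {j} → j < k → f (suc j) < f j) where

  decreasing-gap : ∀ i d → i + d ≤ k → f (i + d) + d ≤ f i
  decreasing-gap i zero    _      = ≤-reflexive (trans (+-identityʳ _) (cong f (+-identityʳ i)))
  decreasing-gap i (suc d) i+1+d≤k = begin
    f (i + suc d) + suc d      ≡⟨ +-suc _ d ⟩
    suc (f (i + suc d)) + d    ≡⟨ cong (λ x → suc (f x) + d) (+-suc i d) ⟩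
    suc (f (suc (i + d))) + d  ≤⟨ +-monoˡ-≤ d (decreasing i+d<k) ⟩
    f (i + d) + d              ≤⟨ decreasing-gap i d (<⇒≤ i+d<k) ⟩
    f i                        ∎
    where
    open ≤-Reasoning
    i+d<k : i + d < k
    i+d<k = subst (_≤ k) (+-suc i d) i+1+d≤k

  decreasing⇒reversal : f 0 ≤ k → ∀ {i} → i ≤ k → f i ≡ k ∸ i
  decreasing⇒reversal f0≤k {i} i≤k = ≤-antisym upper lower
    where
    upper : f i ≤ k ∸ i
    upper = m+n≤o⇒m≤o∸n (f i) (≤-trans (decreasing-gap 0 i i≤k) f0≤k)
    lower : k ∸ i ≤ f i
    lower = m+n≤o⇒n≤o (f (i + (k ∸ i))) (decreasing-gap i (k ∸ i) (≤-reflexive (m+[n∸m]≡n i≤k)))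

drop-block : ∀ m {N f} → Is231AvoidingInvolution (m + N) f → (∀ {i} → i < N → m ≤ f (m + i)) →
  Is231AvoidingInvolution N (λ i → f (m + i) ∸ m)
drop-block m {N} {f} F above = record { bounded = bounded ; involutive = involutive ; avoids231 = avoids231 }
  where
  module F = Is231AvoidingInvolution F
  g : ℕ → ℕ
  g i = f (m + i) ∸ m

  shift : ∀ {i j} → i < j → m + i < m + j
  shift = +-monoʳ-< m

  f≡m+g : ∀ {i} → i < N → f (m + i) ≡ m + g i
  f≡m+g i<N = sym (m+[n∸m]≡n (above i<N))

  bounded : ∀ {i} → i < N → g i < N
  bounded i<N = +-cancelˡ-< m _ _ (subst (_< m + N) (f≡m+g i<N) (F.bounded (shift i<N)))

  involutive : ∀ {i} → i < N → g (g i) ≡ i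
  involutive {i} i<N = begin
    f (m + g i) ∸ m    ≡⟨ cong (λ x → f x ∸ m) (f≡m+g i<N) ⟨
    f (f (m + i)) ∸ m  ≡⟨ cong (_∸ m) (F.involutive (shift i<N)) ⟩
    m + i ∸ m          ≡⟨ m+n∸m≡n m i ⟩
    i                  ∎
    where open ≡-Reasoning

  lift : ∀ {a b} → a < N → b < N → g a < g b → f (m + a) < f (m + b)
  lift a<N b<N ga<gb = subst₂ _<_ (sym (f≡m+g a<N)) (sym (f≡m+g b<N)) (shift ga<gb)

  avoids231 : ∀ {i j k} → i < j → j < k → k < N → ¬ (g k < g i × g i < g j)
  avoids231 {i} {j} i<j j<k k<N (gk<gi , gi<gj) =
    F.avoids231 (shift i<j) (shift j<k) (shift k<N) (lift k<N i<N gk<gi , lift i<N j<N gi<gj)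
    where
    j<N : j < N
    j<N = <-trans j<k k<N
    i<N : i < N
    i<N = <-trans i<j j<N

IsLayered : ℕ → (ℕ → ℕ) → Set
IsLayered n f = ∃[ cs ] size cs ≡ n × (∀ {i} → i < n → f i ≡ layered cs i)

module FirstBlock {n f} (F : Is231AvoidingInvolution (suc n) f) where
  open Is231AvoidingInvolution F

  private
    k : ℕ
    k = f 0
    k<n : k < suc n
    k<n = bounded z<s
    k+N≡n : suc k + (n ∸ k) ≡ suc n
    k+N≡n = m+[n∸m]≡n k<n

  f[k]<f : ∀ {j} → j < k → f k < f j
  f[k]<f {j} j<k = subst (_< f j) (sym (involutive z<s)) (n≢0⇒n>0 λ fj≡0 →
    <⇒≢ j<k (injective (<-trans j<k k<n) k<n (trans fj≡0 (sym (involutive z<s)))))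

  descending : ∀ {j} → j < k → f (suc j) < f j
  descending {j} j<k with m≤n⇒m<n∨m≡n j<k
  ... | inj₂ 1+j≡k = subst (λ x → f x < f j) (sym 1+j≡k) (f[k]<f j<k)
  ... | inj₁ 1+j<k = ≤∧≢⇒< (≮⇒≥ no-ascent)
                       λ e → 1+n≢n (injective (<-trans 1+j<k k<n) (<-trans j<k k<n) e)
    where
    no-ascent : ¬ (f j < f (suc j))
    no-ascent fj<f1+j = avoids231 (n<1+n j) 1+j<k k<n (f[k]<f j<k , fj<f1+j)

  first-block : ∀ {i} → i ≤ k → f i ≡ k ∸ i
  first-block = decreasing⇒reversal f descending ≤-refl

  beyond-first-block : ∀ {i} → i < n ∸ k → suc k ≤ f (suc k + i)
  beyond-first-block {i} i<N = ≰⇒> λ f≤k → <⇒≱ (s≤s (m≤m+n k i)) (begin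
    suc k + i          ≡⟨ involutive 1+k+i<1+n ⟨
    f (f (suc k + i))  ≡⟨ first-block f≤k ⟩
    k ∸ f (suc k + i)  ≤⟨ m∸n≤m k (f (suc k + i)) ⟩
    k                  ∎)
    where
    open ≤-Reasoning
    1+k+i<1+n : suc k + i < suc n
    1+k+i<1+n = subst (suc k + i <_) k+N≡n (+-monoʳ-< (suc k) i<N)

  remainder : ℕ → ℕ
  remainder i = f (suc k + i) ∸ suc k

  remainder-avoiding : Is231AvoidingInvolution (n ∸ k) remainder
  remainder-avoiding =
    drop-block (suc k) (subst (λ m → Is231AvoidingInvolution m f) (sym k+N≡n) F) beyond-first-block

  layered-cons : IsLayered (n ∸ k) remainder → IsLayered (suc n) f
  layered-cons (cs , size-cs , agrees) = k ∷ cs , trans (cong (suc k +_) size-cs) k+N≡n , agrees′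
    where
    agrees′ : ∀ {i} → i < suc n → f i ≡ layered (k ∷ cs) i
    agrees′ {i} i<n with blockView k i
    ... | inBlock i≤k = trans (first-block i≤k) (sym (layered-block k cs i≤k))
    ... | pastBlock i = begin
      f (suc k + i)          ≡⟨ m+[n∸m]≡n (beyond-first-block i<N) ⟨
      suc k + remainder i    ≡⟨ cong (suc k +_) (agrees i<N) ⟩
      suc k + layered cs i   ≡⟨ layered-shift k cs i ⟨
      layered (k ∷ cs) (suc k + i) ∎
      where
      open ≡-Reasoning
      i<N : i < n ∸ k
      i<N = +-cancelˡ-< (suc k) _ _ (subst (suc k + i <_) (sym k+N≡n) i<n)

avoiding⇒layered : ∀ n {f} → Is231AvoidingInvolution n f → IsLayered n f
avoiding⇒layered = <-rec (λ n → ∀ {f} → Is231AvoidingInvolution n f → IsLayered n f) step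
  where
  step : ∀ n → (∀ {m} → m < n → ∀ {g} → Is231AvoidingInvolution m g → IsLayered m g) →
         ∀ {f} → Is231AvoidingInvolution n f → IsLayered n f
  step zero    _   _ = [] , refl , λ ()
  step (suc n) rec {f} F = layered-cons (rec (s≤s (m∸n≤m n (f 0))) remainder-avoiding)
    where open FirstBlock F

-- Layered involutions are shallow

displacement : ℕ → (ℕ → ℕ) → ℕ
displacement n f = ∑[ i < n ] ∣ f i - i ∣

-- For an involution, i ≤ f i exactly when i is the least element of its cycle.
cycleMinima : ℕ → (ℕ → ℕ) → ℕ
cycleMinima n f = ∑[ i < n ] 𝟙 (i ≤? f i)

inversionsAt : ℕ → (ℕ → ℕ) → ℕ → ℕ
inversionsAt n f i = ∑[ j < n ] 𝟙 (i <? j ×-dec f j <? f i)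

inversions : ℕ → (ℕ → ℕ) → ℕ
inversions n f = ∑[ i < n ] inversionsAt n f i

-- I + T = D with T = n ∸ cyc, rearranged so that no truncated subtraction occurs.
IsShallow : ℕ → (ℕ → ℕ) → Set
IsShallow n f = inversions n f + n ≡ displacement n f + cycleMinima n f

displacement-reversal-step : ∀ c →
  displacement (3 + c) (2 + c ∸_) ≡ (2 + c) + (displacement (suc c) (c ∸_) + (2 + c))
displacement-reversal-step c = cong (2 + c +_) (begin
  ∑[ i < 2 + c ] ∣ suc c ∸ i - suc i ∣
    ≡⟨ ∑-snoc (suc c) (λ i → ∣ suc c ∸ i - suc i ∣) ⟩
  ∑[ i < suc c ] ∣ suc c ∸ i - suc i ∣ + ∣ suc c ∸ suc c - 2 + c ∣
    ≡⟨ cong₂ _+_ middle last ⟩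
  ∑[ i < suc c ] ∣ c ∸ i - i ∣ + (2 + c) ∎)
  where
  open ≡-Reasoning
  middle : ∑[ i < suc c ] ∣ suc c ∸ i - suc i ∣ ≡ ∑[ i < suc c ] ∣ c ∸ i - i ∣
  middle = ∑-cong (suc c) λ {i} i<1+c → cong (λ x → ∣ x - suc i ∣) (+-∸-assoc 1 (≤-pred i<1+c))
  last : ∣ suc c ∸ suc c - 2 + c ∣ ≡ 2 + c
  last = cong (λ x → ∣ x - 2 + c ∣) (n∸n≡0 (suc c))

cycleMinima-reversal-step : ∀ c → cycleMinima (3 + c) (2 + c ∸_) ≡ 1 + (cycleMinima (suc c) (c ∸_) + 0)
cycleMinima-reversal-step c = cong (1 +_) (begin
  ∑[ i < 2 + c ] 𝟙 (suc i ≤? suc c ∸ i)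
    ≡⟨ ∑-snoc (suc c) (λ i → 𝟙 (suc i ≤? suc c ∸ i)) ⟩
  ∑[ i < suc c ] 𝟙 (suc i ≤? suc c ∸ i) + 𝟙 (2 + c ≤? suc c ∸ suc c)
    ≡⟨ cong₂ _+_ middle last ⟩
  ∑[ i < suc c ] 𝟙 (i ≤? c ∸ i) + 0 ∎)
  where
  open ≡-Reasoning
  middle : ∑[ i < suc c ] 𝟙 (suc i ≤? suc c ∸ i) ≡ ∑[ i < suc c ] 𝟙 (i ≤? c ∸ i)
  middle = ∑-cong (suc c) λ {i} i<1+c → 𝟙-cong (suc i ≤? suc c ∸ i) (i ≤? c ∸ i)
    (λ le → ≤-pred (≤-trans le (≤-reflexive (+-∸-assoc 1 (≤-pred i<1+c)))))
    (λ le → ≤-trans (s≤s le) (≤-reflexive (sym (+-∸-assoc 1 (≤-pred i<1+c)))))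
  last : 𝟙 (2 + c ≤? suc c ∸ suc c) ≡ 0
  last = cong (λ x → 𝟙 (2 + c ≤? x)) (n∸n≡0 (suc c))

reversal-shallow : ∀ c →
  ∑[ i < suc c ] (c ∸ i) + suc c ≡ displacement (suc c) (c ∸_) + cycleMinima (suc c) (c ∸_)
reversal-shallow zero          = refl
reversal-shallow (suc zero)    = refl
reversal-shallow (suc (suc c)) = begin
  (2 + c) + ((1 + c) + R) + (3 + c)  ≡⟨ rearrangeˡ R c ⟩
  (2 + c) + (2 + c) + 1 + (R + suc c) ≡⟨ cong ((2 + c) + (2 + c) + 1 +_) (reversal-shallow c) ⟩
  (2 + c) + (2 + c) + 1 + (A + B)    ≡⟨ rearrangeʳ A B c ⟩
  (2 + c) + (A + (2 + c)) + (1 + (B + 0)) ≡⟨ cong₂ _+_ (displacement-reversal-step c) (cycleMinima-reversal-step c) ⟨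
  displacement (3 + c) (2 + c ∸_) + cycleMinima (3 + c) (2 + c ∸_) ∎
  where
  open ≡-Reasoning
  R A B : ℕ
  R = ∑[ i < suc c ] (c ∸ i)
  A = displacement (suc c) (c ∸_)
  B = cycleMinima (suc c) (c ∸_)
  rearrangeˡ : ∀ r c → (2 + c) + ((1 + c) + r) + (3 + c) ≡ (2 + c) + (2 + c) + 1 + (r + (1 + c))
  rearrangeˡ = solve-∀
  rearrangeʳ : ∀ a b c → (2 + c) + (2 + c) + 1 + (a + b) ≡ (2 + c) + (a + (2 + c)) + (1 + (b + 0))
  rearrangeʳ = solve-∀

module _ (c : ℕ) (cs : List ℕ) where
  private
    M : ℕ
    M = size cs
    f g : ℕ → ℕ
    f = layered (c ∷ cs)
    g = layered cs

  ∑-layered-cons : (φ : ℕ → ℕ → ℕ) → (∀ m i y → φ (m + i) (m + y) ≡ φ i y) →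
    ∑[ i < suc c + M ] φ i (f i) ≡ ∑[ i < suc c ] φ i (c ∸ i) + ∑[ i < M ] φ i (g i)
  ∑-layered-cons φ φ-shift = trans (∑-+ (suc c) M (λ i → φ i (f i))) (cong₂ _+_
    (∑-cong (suc c) λ {i} i<1+c → cong (φ i) (layered-block c cs (≤-pred i<1+c)))
    (∑-cong M λ {i} _ → trans (cong (φ (suc c + i)) (layered-shift c cs i)) (φ-shift (suc c) i (g i))))

  inversionsAt-block : ∀ {i} → i ≤ c → inversionsAt (suc c + M) f i ≡ c ∸ i
  inversionsAt-block {i} i≤c = begin
    inversionsAt (suc c + M) f i
      ≡⟨ ∑-+ (suc c) M (λ j → 𝟙 (i <? j ×-dec f j <? f i)) ⟩
    ∑[ j < suc c ] 𝟙 (i <? j ×-dec f j <? f i) + ∑[ j < M ] 𝟙 (i <? suc c + j ×-dec f (suc c + j) <? f i)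
      ≡⟨ cong₂ _+_ (∑-cong (suc c) block-term) (∑-zero M pastBlock-term) ⟩
    ∑[ j < suc c ] 𝟙 (i <? j) + 0
      ≡⟨ +-identityʳ _ ⟩
    ∑[ j < suc c ] 𝟙 (i <? j)
      ≡⟨ ∑-𝟙-< i (suc c) ⟩
    c ∸ i ∎
    where
    open ≡-Reasoning
    block-term : ∀ {j} → j < suc c → 𝟙 (i <? j ×-dec f j <? f i) ≡ 𝟙 (i <? j)
    block-term {j} j<1+c = 𝟙-cong (i <? j ×-dec f j <? f i) (i <? j) proj₁ λ i<j → i<j ,
      subst₂ _<_ (sym (layered-block c cs (≤-pred j<1+c))) (sym (layered-block c cs i≤c))
        (∸-monoʳ-< i<j (≤-pred j<1+c))
    pastBlock-term : ∀ {j} → j < M → 𝟙 (i <? suc c + j ×-dec f (suc c + j) <? f i) ≡ 0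
    pastBlock-term {j} _ = 𝟙-no (i <? suc c + j ×-dec f (suc c + j) <? f i) λ (_ , f[c+j]<fi) →
      <-asym f[c+j]<fi (layered-block<shift c cs i≤c j)

  inversionsAt-shift : ∀ {i} → i < M → inversionsAt (suc c + M) f (suc c + i) ≡ inversionsAt M g i
  inversionsAt-shift {i} _ = begin
    inversionsAt (suc c + M) f (suc c + i)
      ≡⟨ ∑-+ (suc c) M (λ j → 𝟙 (suc c + i <? j ×-dec f j <? f (suc c + i))) ⟩
    ∑[ j < suc c ] 𝟙 (suc c + i <? j ×-dec f j <? f (suc c + i))
      + ∑[ j < M ] 𝟙 (suc c + i <? suc c + j ×-dec f (suc c + j) <? f (suc c + i))
      ≡⟨ cong₂ _+_ (∑-zero (suc c) block-term) (∑-cong M pastBlock-term) ⟩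
    inversionsAt M g i ∎
    where
    open ≡-Reasoning
    block-term : ∀ {j} → j < suc c → 𝟙 (suc c + i <? j ×-dec f j <? f (suc c + i)) ≡ 0
    block-term {j} j<1+c = 𝟙-no (suc c + i <? j ×-dec f j <? f (suc c + i)) λ (c+i<j , _) →
      pastBlock≰block c i (<⇒≤ (<-≤-trans c+i<j (≤-pred j<1+c)))
    pastBlock-term : ∀ {j} → j < M →
      𝟙 (suc c + i <? suc c + j ×-dec f (suc c + j) <? f (suc c + i)) ≡ 𝟙 (i <? j ×-dec g j <? g i)
    pastBlock-term {j} _ =
      𝟙-cong (suc c + i <? suc c + j ×-dec f (suc c + j) <? f (suc c + i)) (i <? j ×-dec g j <? g i)
      (λ (c+i<c+j , f<f) → unshift c+i<c+j , unshift (subst₂ _<_ (layered-shift c cs j) (layered-shift c cs i) f<f))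
      (λ (i<j , gj<gi) → shift i<j , subst₂ _<_ (sym (layered-shift c cs j)) (sym (layered-shift c cs i)) (shift gj<gi))
      where
      shift : ∀ {a b} → a < b → suc c + a < suc c + b
      shift = +-monoʳ-< (suc c)
      unshift : ∀ {a b} → suc c + a < suc c + b → a < b
      unshift = +-cancelˡ-< (suc c) _ _

  inversions-cons : inversions (suc c + M) f ≡ ∑[ i < suc c ] (c ∸ i) + inversions M g
  inversions-cons = trans (∑-+ (suc c) M (inversionsAt (suc c + M) f))
    (cong₂ _+_ (∑-cong (suc c) (inversionsAt-block ∘ ≤-pred)) (∑-cong M inversionsAt-shift))

layered-shallow : ∀ cs → IsShallow (size cs) (layered cs)
layered-shallow []       = refl
layered-shallow (c ∷ cs) = begin
  inversions N f + N                  ≡⟨ cong (_+ N) (inversions-cons c cs) ⟩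
  (R + inversions M g) + (suc c + M)  ≡⟨ interchange R _ (suc c) M ⟩
  (R + suc c) + (inversions M g + M)  ≡⟨ cong₂ _+_ (reversal-shallow c) (layered-shallow cs) ⟩
  (A + B) + (displacement M g + cycleMinima M g)  ≡⟨ interchange A B _ _ ⟩
  (A + displacement M g) + (B + cycleMinima M g)  ≡⟨ cong₂ _+_ (∑-layered-cons c cs _ ∣m+n-m+o∣-shift)
                                                                (∑-layered-cons c cs _ ≤-shift) ⟨
  displacement N f + cycleMinima N f  ∎
  where
  open ≡-Reasoning
  M N R A B : ℕ
  M = size cs
  N = suc c + M
  R = ∑[ i < suc c ] (c ∸ i)
  A = displacement (suc c) (c ∸_)
  B = cycleMinima (suc c) (c ∸_)
  f g : ℕ → ℕ
  f = layered (c ∷ cs)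
  g = layered cs
  ∣m+n-m+o∣-shift : ∀ m i y → ∣ m + y - m + i ∣ ≡ ∣ y - i ∣
  ∣m+n-m+o∣-shift m i y = ∣m+n-m+o∣≡∣n-o∣ m y i
  ≤-shift : ∀ m i y → 𝟙 (m + i ≤? m + y) ≡ 𝟙 (i ≤? y)
  ≤-shift m i y = 𝟙-cong (m + i ≤? m + y) (i ≤? y) (+-cancelˡ-≤ m i y) (+-monoʳ-≤ m)

-- From words to functions on ℕ

sum-allFin : ∀ n {g : Fin n → ℕ} (h : ℕ → ℕ) → (∀ i → g i ≡ h (toℕ i)) →
  sum (map g (allFin n)) ≡ ∑[ i < n ] h i
sum-allFin n {g} h g≡h = trans (cong sum (map-tabulate (λ i → i) g)) (sum-tabulate n h g≡h)
  where
  sum-tabulate : ∀ n (h : ℕ → ℕ) {g : Fin n → ℕ} → (∀ i → g i ≡ h (toℕ i)) →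
    sum (List.tabulate g) ≡ ∑[ i < n ] h i
  sum-tabulate zero    h g≡h = refl
  sum-tabulate (suc n) h g≡h = cong₂ _+_ (g≡h fzero) (sum-tabulate n (h ∘ suc) (g≡h ∘ fsuc))

iter-involution : ∀ {n} (w : Word n) → IsInvolution w → ∀ m i → iter w m i ≡ i ⊎ iter w m i ≡ lookup w i
iter-involution w inv zero    i = inj₁ refl
iter-involution w inv (suc m) i with iter-involution w inv m i
... | inj₁ wᵐi≡i  = inj₂ (cong (lookup w) wᵐi≡i)
... | inj₂ wᵐi≡wi = inj₁ (trans (cong (lookup w) wᵐi≡wi) (inv i))

cycleMin⇔ : ∀ {n} (w : Word n) → IsInvolution w → ∀ i → CycleMin w i ⇔ toℕ i ≤ val w i
cycleMin⇔ {suc n} w inv i =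
  mk⇔ (λ min → min fzero) λ i≤wi k → bound i≤wi (iter-involution w inv (suc (toℕ k)) i)
  where
  bound : ∀ {x} → toℕ i ≤ val w i → x ≡ i ⊎ x ≡ lookup w i → toℕ i ≤ toℕ x
  bound _    (inj₁ refl) = ≤-refl
  bound i≤wi (inj₂ refl) = i≤wi

-- A record rather than a function type, so that w and h can be inferred from the type of a proof.
record Represents {n} (w : Word n) (h : ℕ → ℕ) : Set where
  constructor represents
  field
    val≡ : ∀ i → val w i ≡ h (toℕ i)

tabulateWord : ∀ {n} (h : ℕ → ℕ) → (∀ {i} → i < n → h i < n) → Word n
tabulateWord h h<n = tabulate λ i → fromℕ< (h<n (toℕ<n i))

tabulateWord-represents : ∀ {n} (h : ℕ → ℕ) (h<n : ∀ {i} → i < n → h i < n) →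
  Represents (tabulateWord h h<n) h
tabulateWord-represents h h<n = represents λ i → trans (cong toℕ (lookup∘tabulate _ i)) (toℕ-fromℕ< _)

wordFun : ∀ {n} → Word n → ℕ → ℕ
wordFun {n} w x with x <? n
... | yes x<n = val w (fromℕ< x<n)
... | no  _   = 0

wordFun-represents : ∀ {n} (w : Word n) → Represents w (wordFun w)
wordFun-represents {n} w = represents val≡
  where
  val≡ : ∀ i → val w i ≡ wordFun w (toℕ i)
  val≡ i with toℕ i <? n
  ... | yes i<n = cong (val w) (sym (fromℕ<-toℕ i i<n))
  ... | no  i≮n = contradiction (toℕ<n i) i≮n

represents-unique : ∀ {n} {w w′ : Word n} {h h′ : ℕ → ℕ} → Represents w h → Represents w′ h′ →
  (∀ {x} → x < n → h x ≡ h′ x) → w ≡ w′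
represents-unique {w = w} {w′} (represents w≈h) (represents w′≈h′) h≡h′ = begin
  w                    ≡⟨ tabulate∘lookup w ⟨
  tabulate (lookup w)  ≡⟨ tabulate-cong lookup≗ ⟩
  tabulate (lookup w′) ≡⟨ tabulate∘lookup w′ ⟩
  w′                   ∎
  where
  open ≡-Reasoning
  lookup≗ : ∀ i → lookup w i ≡ lookup w′ i
  lookup≗ i = toℕ-injective (trans (w≈h i) (trans (h≡h′ (toℕ<n i)) (sym (w′≈h′ i))))

module _ {n} {w : Word n} {h : ℕ → ℕ} (rep : Represents w h) where
  open Represents rep renaming (val≡ to w≈h)

  h≡val : ∀ {x} (x<n : x < n) → h x ≡ val w (fromℕ< x<n)
  h≡val {x} x<n = trans (cong h (sym (toℕ-fromℕ< x<n))) (sym (w≈h (fromℕ< x<n)))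

  represented-avoiding : IsInvolution w → Avoids231 w → Is231AvoidingInvolution n h
  represented-avoiding inv avoids = record { bounded = bounded ; involutive = involutive ; avoids231 = avoids231 }
    where
    bounded : ∀ {x} → x < n → h x < n
    bounded x<n rewrite h≡val x<n = toℕ<n _
    involutive : ∀ {x} → x < n → h (h x) ≡ x
    involutive {x} x<n = begin
      h (h x)                             ≡⟨ cong h (h≡val x<n) ⟩
      h (val w (fromℕ< x<n))              ≡⟨ w≈h (lookup w (fromℕ< x<n)) ⟨
      toℕ (lookup w (lookup w (fromℕ< x<n))) ≡⟨ cong toℕ (inv (fromℕ< x<n)) ⟩
      toℕ (fromℕ< x<n)                    ≡⟨ toℕ-fromℕ< x<n ⟩
      x                                   ∎
      where open ≡-Reasoning
    avoids231 : ∀ {i j k} → i < j → j < k → k < n → ¬ (h k < h i × h i < h j)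
    avoids231 {i} {j} {k} i<j j<k k<n (hk<hi , hi<hj) = avoids (fromℕ< i<n) (fromℕ< j<n) (fromℕ< k<n)
      (subst₂ _<_ (sym (toℕ-fromℕ< i<n)) (sym (toℕ-fromℕ< j<n)) i<j)
      (subst₂ _<_ (sym (toℕ-fromℕ< j<n)) (sym (toℕ-fromℕ< k<n)) j<k)
      (subst₂ _<_ (h≡val k<n) (h≡val i<n) hk<hi , subst₂ _<_ (h≡val i<n) (h≡val j<n) hi<hj)
      where
      j<n : j < n
      j<n = <-trans j<k k<n
      i<n : i < n
      i<n = <-trans i<j j<n

  avoiding-represented : Is231AvoidingInvolution n h → IsPerm w × IsInvolution w × Avoids231 w
  avoiding-represented H = perm , inv , avoids
    where
    open Is231AvoidingInvolution H
    perm : IsPerm w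
    perm i j wi≡wj = toℕ-injective (injective (toℕ<n i) (toℕ<n j)
      (trans (sym (w≈h i)) (trans (cong toℕ wi≡wj) (w≈h j))))
    inv : IsInvolution w
    inv i = toℕ-injective (trans (w≈h (lookup w i)) (trans (cong h (w≈h i)) (involutive (toℕ<n i))))
    avoids : Avoids231 w
    avoids i j k i<j j<k (wk<wi , wi<wj) = avoids231 i<j j<k (toℕ<n k)
      (subst₂ _<_ (w≈h k) (w≈h i) wk<wi , subst₂ _<_ (w≈h i) (w≈h j) wi<wj)

  Dis≡displacement : Dis w ≡ displacement n h
  Dis≡displacement = sum-allFin n _ λ i → cong (λ x → ∣ x - toℕ i ∣) (w≈h i)

  Inv≡inversions : Inv w ≡ inversions n h
  Inv≡inversions = sum-allFin n _ λ i → trans (length-filter≡sum-𝟙 _ (allFin n)) (sum-allFin n _ λ j →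
    cong₂ (λ y x → 𝟙 (toℕ i <? toℕ j ×-dec y <? x)) (w≈h j) (w≈h i))

  cyc≡cycleMinima : IsInvolution w → cyc w ≡ cycleMinima n h
  cyc≡cycleMinima inv = trans (length-filter≡sum-𝟙 (cycleMin? w) (allFin n)) (sum-allFin n _ λ i →
    trans (𝟙-cong (cycleMin? w i) (toℕ i ≤? val w i) (Equivalence.to (cycleMin⇔ w inv i))
                                                      (Equivalence.from (cycleMin⇔ w inv i)))
          (cong (λ x → 𝟙 (toℕ i ≤? x)) (w≈h i)))

  represented-shallow : IsInvolution w → IsShallow n h → Shallow w
  represented-shallow inv shallow = +-cancelʳ-≡ (cyc w) _ _ (begin
    Inv w + (n ∸ cyc w) + cyc w         ≡⟨ +-assoc (Inv w) _ _ ⟩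
    Inv w + (n ∸ cyc w + cyc w)         ≡⟨ cong (Inv w +_) (m∸n+n≡m cyc≤n) ⟩
    Inv w + n                           ≡⟨ cong (_+ n) Inv≡inversions ⟩
    inversions n h + n                  ≡⟨ shallow ⟩
    displacement n h + cycleMinima n h  ≡⟨ cong₂ _+_ Dis≡displacement (cyc≡cycleMinima inv) ⟨
    Dis w + cyc w                       ∎)
    where
    open ≡-Reasoning
    cyc≤n : cyc w ≤ n
    cyc≤n = ≤-trans (length-filter (cycleMin? w) (allFin n)) (≤-reflexive (length-tabulate (λ i → i)))

-- Compositions

extendBlock : ℕ × List ℕ → ℕ × List ℕ
extendBlock (c , cs) = suc c , cs

newBlock : ℕ × List ℕ → ℕ × List ℕ
newBlock (c , cs) = 0 , c ∷ cs

-- bᵢ = 1 marks a cut between positions i and i+1 of {0,…,m}; parts are stored as size − 1.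
blocks : ∀ {m} → Vec (Fin 2) m → ℕ × List ℕ
blocks []                = 0 , []
blocks (fzero      ∷ b) = extendBlock (blocks b)
blocks (fsuc fzero ∷ b) = newBlock (blocks b)

composition : ∀ {m} → Vec (Fin 2) m → List ℕ
composition = uncurry _∷_ ∘ blocks

size-composition : ∀ {m} (b : Vec (Fin 2) m) → size (composition b) ≡ suc m
size-composition []                = refl
size-composition (fzero      ∷ b) = cong suc (size-composition b)
size-composition (fsuc fzero ∷ b) = cong suc (size-composition b)

blocks-injective : ∀ {m} (b b′ : Vec (Fin 2) m) → blocks b ≡ blocks b′ → b ≡ b′
blocks-injective []                []                 _ = refl
blocks-injective (fzero      ∷ b) (fzero      ∷ b′) e =
  cong (fzero ∷_) (blocks-injective b b′ (cong (λ (c , cs) → pred c , cs) e))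
blocks-injective (fsuc fzero ∷ b) (fsuc fzero ∷ b′) e =
  cong (fsuc fzero ∷_) (blocks-injective b b′ (uncurry (cong₂ _,_) (∷-injective (cong proj₂ e))))
blocks-injective (fzero      ∷ b) (fsuc fzero ∷ b′) e = contradiction (cong proj₁ e) 1+n≢0
blocks-injective (fsuc fzero ∷ b) (fzero      ∷ b′) e = contradiction (sym (cong proj₁ e)) 1+n≢0

blocks-surjective : ∀ m c cs → size (c ∷ cs) ≡ suc m → Σ[ b ∈ Vec (Fin 2) m ] blocks b ≡ (c , cs)
blocks-surjective zero    zero    []        _ = [] , refl
blocks-surjective zero    zero    (_ ∷ _)   ()
blocks-surjective zero    (suc _) _         ()
blocks-surjective (suc m) zero    []        ()
blocks-surjective (suc m) zero    (c ∷ cs) e with blocks-surjective m c cs (suc-injective e)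
... | b , blocks-b = fsuc fzero ∷ b , cong newBlock blocks-b
blocks-surjective (suc m) (suc c) cs        e with blocks-surjective m c cs (suc-injective e)
... | b , blocks-b = fzero ∷ b , cong extendBlock blocks-b

layered-injective : ∀ cs cs′ → size cs ≡ size cs′ →
  (∀ {x} → x < size cs → layered cs x ≡ layered cs′ x) → cs ≡ cs′
layered-injective []       []         _       _      = refl
layered-injective (c ∷ cs) (c′ ∷ cs′) size≡ agrees
  with trans (sym (layered-block c cs z≤n)) (trans (agrees z<s) (layered-block c′ cs′ z≤n))
... | refl = cong (c ∷_) (layered-injective cs cs′ (+-cancelˡ-≡ (suc c) _ _ size≡) λ {x} x<M →
  +-cancelˡ-≡ (suc c) _ _ (trans (sym (layered-shift c cs x))
    (trans (agrees (+-monoʳ-< (suc c) x<M)) (layered-shift c cs′ x))))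

composition-injective : ∀ {m} {b b′ : Vec (Fin 2) m} →
  (∀ {x} → x < suc m → layered (composition b) x ≡ layered (composition b′) x) → b ≡ b′
composition-injective {m} {b} {b′} agrees = blocks-injective b b′
  (uncurry (cong₂ _,_) (∷-injective (layered-injective (composition b) (composition b′)
    (trans (size-composition b) (sym (size-composition b′)))
    (λ {x} x<size → agrees {x} (subst (x <_) (size-composition b) x<size)))))

module _ (m : ℕ) where

  composition-avoiding : (b : Vec (Fin 2) m) → Is231AvoidingInvolution (suc m) (layered (composition b))
  composition-avoiding b = subst (λ n → Is231AvoidingInvolution n (layered (composition b)))
    (size-composition b) (layered-avoiding (composition b))

  layeredWord : Vec (Fin 2) m → Word (suc m)
  layeredWord b = tabulateWord (layered (composition b)) (Is231AvoidingInvolution.bounded (composition-avoiding b))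

  layeredWord-represents : (b : Vec (Fin 2) m) → Represents (layeredWord b) (layered (composition b))
  layeredWord-represents b =
    tabulateWord-represents (layered (composition b)) (Is231AvoidingInvolution.bounded (composition-avoiding b))

  composition-shallow : (b : Vec (Fin 2) m) → IsShallow (suc m) (layered (composition b))
  composition-shallow b =
    subst (λ n → IsShallow n (layered (composition b))) (size-composition b) (layered-shallow (composition b))

  layeredWord-sai : ∀ b → ShallowAvoidingInvolution (layeredWord b)
  layeredWord-sai b with avoiding-represented (layeredWord-represents b) (composition-avoiding b)
  ... | perm , inv , avoids =
    perm , inv , avoids , represented-shallow (layeredWord-represents b) inv (composition-shallow b)

  layered⇒layeredWord : ∀ {w h} → Represents w h → IsLayered (suc m) h →
    Σ[ b ∈ Vec (Fin 2) m ] w ≡ layeredWord b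
  layered⇒layeredWord rep (c ∷ cs , size≡ , agrees) with blocks-surjective m c cs size≡
  ... | b , blocks-b = b , represents-unique rep (layeredWord-represents b) λ {x} x<n →
    trans (agrees x<n) (cong (λ cs → layered cs x) (sym (cong (uncurry _∷_) blocks-b)))

  sai⇒layeredWord : ∀ {w} → ShallowAvoidingInvolution w → Σ[ b ∈ Vec (Fin 2) m ] w ≡ layeredWord b
  sai⇒layeredWord {w} (_ , inv , avoids , _) = layered⇒layeredWord (wordFun-represents w)
    (avoiding⇒layered (suc m) (represented-avoiding (wordFun-represents w) inv avoids))

  layeredWord-injective : ∀ {b b′} → layeredWord b ≡ layeredWord b′ → b ≡ b′
  layeredWord-injective {b} {b′} e = composition-injective λ {x} x<n → begin
    layered (composition b) x          ≡⟨ h≡val (layeredWord-represents b) x<n ⟩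
    val (layeredWord b) (fromℕ< x<n)   ≡⟨ cong (λ w → val w (fromℕ< x<n)) e ⟩
    val (layeredWord b′) (fromℕ< x<n)  ≡⟨ h≡val (layeredWord-represents b′) x<n ⟨
    layered (composition b′) x         ∎
    where open ≡-Reasoning

  layeredWords : List (Word (suc m))
  layeredWords = map layeredWord (allVecs 2 m)

  layeredWords-unique : Unique layeredWords
  layeredWords-unique = Unique.map⁺ {f = layeredWord} layeredWord-injective (allVecs-unique 2 m)

  ∈-layeredWords⇒sai : ∀ {w} → w ∈ layeredWords → ShallowAvoidingInvolution w
  ∈-layeredWords⇒sai w∈ =
    let b , _ , w≡ = ∈-map⁻ layeredWord w∈ in subst ShallowAvoidingInvolution (sym w≡) (layeredWord-sai b)

  sai⇒∈-layeredWords : ∀ {w} → ShallowAvoidingInvolution w → w ∈ layeredWords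
  sai⇒∈-layeredWords sai =
    let b , w≡ = sai⇒layeredWord sai in subst (_∈ layeredWords) (sym w≡) (∈-map⁺ layeredWord (∈-allVecs b))

theorem4p7 : (n : ℕ) → 1 ≤ n → countSAI n ≡ 2 ^ (n ∸ 1)
theorem4p7 (suc m) _ = begin
  length (filter sai? (allVecs (suc m) (suc m)))
    ≡⟨ length-filter-enumeration sai? (allVecs-unique (suc m) (suc m)) ∈-allVecs
         (layeredWords-unique m) (∈-layeredWords⇒sai m) (sai⇒∈-layeredWords m) ⟩
  length (layeredWords m)  ≡⟨ length-map (layeredWord m) (allVecs 2 m) ⟩
  length (allVecs 2 m)     ≡⟨ length-allVecs 2 m ⟩
  2 ^ m                    ∎
  where open ≡-Reasoning
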